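{- Let $(\underline n,\operatorname{rk})$ be a polymatroid on $\underline n=\{1,\dots,n\}$, let $r=(r_1,\dots,r_n)$ with $r_i=\operatorname{rk}(\{1,\dots,i\})-\operatorname{rk}(\{1,\dots,i-1\})$, and for $v\in\mathbb{Z}^n$ let $\mu_v(h)=h(v)-\lim_{\varepsilon\downarrow0}\chi([v+\varepsilon\Delta]\cdot h)$ for $h\in\mathcal{K}(\mathbb{R}^n)$. Then $\mu_v([Q(\operatorname{rk})])=1$ if $v=r$ and $\mu_v([Q(\operatorname{rk})])=0$ otherwise.
   Context: A polymatroid rank function on $\underline n$ takes values in $\{0,1,2,\dots\}$, has $\operatorname{rk}(\emptyset)=0$, is monotone and submodular. $Q(\operatorname{rk})=\{v\in\mathbb{R}^n:\sum_{i=1}^nv_i=\operatorname{rk}(\underline n),\ \sum_{i\in A}v_i\le\operatorname{rk}(A)\ \forall A\subseteq\underline n\}$. For $\Pi\subseteq\mathbb{R}^n$, $[\Pi]$ is its characteristic function. $\mathcal{K}(\mathbb{R}^n)$ is the real vector space spanned by the functions $[\Pi]$ for compact convex polytopes $\Pi\subseteq\mathbb{R}^n$ (closed under pointwise product), and $\chi:\mathcal{K}(\mathbb{R}^n)\to\mathbb{R}$ is the Euler characteristic, the linear map with $\chi([\Pi])=1$ for every nonempty compact convex polytope $\Pi$ (so $\chi(0)=0$). $e_1,\dots,e_n$ is the standard basis and $\Delta$ is the simplex spanned by $e_1-e_2,\dots,e_{n-1}-e_n$.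
   Formalization: Points of $v+\varepsilon\Delta$ and $Q(\operatorname{rk})$ are taken in ℚ^n rather than ℝ^n, and the limit as ε decreases to 0 runs over rational ε only. -}

module Defs where

open import Data.Nat as ℕ using (ℕ; zero; suc; _∸_; _<ᵇ_; _≡ᵇ_)
open import Data.Integer as ℤ using (ℤ; +_)
open import Data.Fin using (Fin; zero; suc; toℕ)
open import Data.Bool using (Bool; true; false; if_then_else_; _∧_; _∨_; T)
open import Data.Rational using (ℚ; 0ℚ; 1ℚ; _+_; _*_; _-_; _≤_; _<_; _/_)
open import Data.Product using (Σ; _×_; ∃)
open import Relation.Binary.PropositionalEquality using (_≡_)
open import Relation.Nullary using (¬_)

Subset : ℕ → Set
Subset n = Fin n → Bool

_⊆_ : ∀ {n} → Subset n → Subset n → Set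
A ⊆ B = ∀ i → T (A i) → T (B i)

_∪_ _∩_ : ∀ {n} → Subset n → Subset n → Subset n
(A ∪ B) i = A i ∨ B i
(A ∩ B) i = A i ∧ B i

∅ full : ∀ {n} → Subset n
∅ _ = false
full _ = true

-- the initial segment {1,…,m} (0-indexed: indices j with toℕ j < m)
prefix : ∀ {n} → ℕ → Subset n
prefix m j = toℕ j <ᵇ m

record IsPolymatroid (n : ℕ) (rk : Subset n → ℕ) : Set where
  field
    rk-∅         : rk ∅ ≡ 0
    monotone     : ∀ A B → A ⊆ B → rk A ℕ.≤ rk B
    submodular   : ∀ A B → rk (A ∪ B) ℕ.+ rk (A ∩ B) ℕ.≤ rk A ℕ.+ rk B

Σℚ : ∀ n → (Fin n → ℚ) → ℚ
Σℚ zero    f = 0ℚ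
Σℚ (suc n) f = f zero + Σℚ n (λ i → f (suc i))

ℕ→ℚ : ℕ → ℚ
ℕ→ℚ k = + k / 1

ℤ→ℚ : ℤ → ℚ
ℤ→ℚ z = z / 1

ΣOver : ∀ {n} → Subset n → (Fin n → ℚ) → ℚ
ΣOver {n} A v = Σℚ n (λ i → if A i then v i else 0ℚ)

_∈Q_ : ∀ {n} → (Fin n → ℚ) → (Subset n → ℕ) → Set
_∈Q_ {n} v rk = (Σℚ n v ≡ ℕ→ℚ (rk full)) × (∀ A → ΣOver A v ≤ ℕ→ℚ (rk A))

-- the vector r, r_i = rk({1..i}) - rk({1..i-1})  (here i = toℕ k + 1)
rvec : ∀ {n} → (Subset n → ℕ) → Fin n → ℤ
rvec rk k = + rk (prefix (suc (toℕ k))) ℤ.- + rk (prefix (toℕ k))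

δ : ℕ → ℕ → ℚ
δ a b = if a ≡ᵇ b then 1ℚ else 0ℚ

-- the generator e_i - e_{i+1} of Δ (only used for toℕ i + 1 < n)
gen : ∀ {n} → Fin n → Fin n → ℚ
gen i j = δ (toℕ j) (toℕ i) - δ (toℕ j) (suc (toℕ i))

-- The simplex Δ = conv{e_1-e_2,…,e_{n-1}-e_n}: points Σ λ_i (e_i - e_{i+1})
-- with λ ≥ 0, Σ λ = 1, λ supported on the indices i with i+1 < n.
-- (For n ≤ 1 it is empty.)  Point w lies in v + εΔ:
InTranslatedSimplex : ∀ {n} → (Fin n → ℚ) → ℚ → (Fin n → ℚ) → Set
InTranslatedSimplex {n} v ε w =
  Σ (Fin n → ℚ) λ lam →
    (∀ i → 0ℚ ≤ lam i) ×
    (∀ i → T (n <ᵇ suc (suc (toℕ i))) → lam i ≡ 0ℚ) ×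
    (Σℚ n lam ≡ 1ℚ) ×
    (∀ j → w j ≡ v j + ε * Σℚ n (λ i → lam i * gen i j))

IndicatorIs : Set → ℤ → Set
IndicatorIs P b = (b ≡ + 1 × P) ⊎' (b ≡ + 0 × ¬ P)
  where
    open import Data.Sum using () renaming (_⊎_ to _⊎'_)

-- χ([v+εΔ]·[Q]) : the product is the indicator of the compact convex
-- polytope (v+εΔ) ∩ Q, so χ of it is 1 if nonempty and 0 otherwise.
χSimplexQ : ∀ {n} → (Fin n → ℚ) → (Subset n → ℕ) → ℚ → ℤ → Set
χSimplexQ v rk ε c =
  IndicatorIs (∃ λ w → InTranslatedSimplex v ε w × w ∈Q rk) c

-- μ_v([Q(rk)]) = m :  [Q](v) - lim_{ε↓0} χ([v+εΔ]·[Q]) = m,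
-- where the limit L exists (χ-values are eventually equal to L).
μQ≡ : ∀ {n} → (Fin n → ℤ) → (Subset n → ℕ) → ℤ → Set
μQ≡ v rk m =
  Σ ℤ λ a → Σ ℤ λ L →
    IndicatorIs ((λ i → ℤ→ℚ (v i)) ∈Q rk) a ×
    (Σ ℚ λ ε₀ → (0ℚ < ε₀) ×
      (∀ ε → 0ℚ < ε → ε < ε₀ → χSimplexQ (λ i → ℤ→ℚ (v i)) rk ε L)) ×
    (a ℤ.- L ≡ m)

-- Write r for the greedy vector. It lies in Q and every prefix constraint is tight at r, so each
-- direction Σ tᵢ (eᵢ - eᵢ₊₁) of Δ raises the sum over some prefix above its rank: (r + εΔ) ∩ Q = ∅,
-- and μ_r = 1 - 0. For v ≠ r outside Q, the failing equation or inequality keeps failing on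
-- v + εΔ for small ε, so μ_v = 0 - 0. For v ≠ r in Q, let i be the first index with vᵢ ≠ rᵢ; the
-- prefix constraint ending at i gives vᵢ < rᵢ. Then some j > i has every set containing i but not j
-- slack, since otherwise the intersection of tight sets separating i from all later indices would be
-- tight (by submodularity) and force vᵢ ≥ rᵢ. Moving along eᵢ - eⱼ ∈ (j - i) Δ keeps v + εΔ meeting Q
-- for small ε, so μ_v = 1 - 1.

module Submission where

open import Defs
open import Data.Bool using (Bool; true; false; if_then_else_; _∧_; _∨_; not; T)
open import Data.Bool.Properties using (∧-zeroʳ; ∧-identityʳ; if-eta; T-∧) renaming (_≟_ to _≟ᵇ_)
open import Data.Empty using (⊥-elim)
open import Data.Fin using (Fin; zero; suc; toℕ; fromℕ<)
open import Data.Fin.Properties using (toℕ-injective; toℕ<n; toℕ-inject; toℕ-fromℕ<; ¬∀⟶∃¬-smallest)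
open import Data.Integer as ℤ using (ℤ; +_)
import Data.Integer.Properties as ℤ
open import Data.Nat as ℕ using (ℕ; zero; suc; z≤n; s≤s; _<ᵇ_; _≡ᵇ_)
import Data.Nat.Properties as ℕ
open import Data.Product using (Σ; ∃; _×_; _,_; proj₁; proj₂)
open import Data.Rational
  using (ℚ; 0ℚ; 1ℚ; _+_; _*_; _-_; -_; _≤_; _<_; _⊓_; 1/_; toℚᵘ; Positive; NonZero; positive; nonNegative)
open import Data.Rational.Properties
import Data.Rational.Unnormalised as ℚᵘ
import Data.Rational.Unnormalised.Properties as ℚᵘ
open import Data.Rational.Solver using (module +-*-Solver)
open +-*-Solver using (solve; _:+_; _:-_; _:*_; :-_; _:=_; con)
open import Data.Sum using (_⊎_; inj₁; inj₂; [_,_]′)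
open import Data.Unit using (tt)
open import Function using (_∘_)
open import Function.Bundles using (module Equivalence)
open import Relation.Nullary using (¬_; Dec; yes; no)
open import Relation.Nullary.Decidable using (toWitness; _→-dec_)
open import Relation.Binary.PropositionalEquality

toℚᵘ-ℤ→ℚ : ∀ z → toℚᵘ (ℤ→ℚ z) ℚᵘ.≃ ℚᵘ.mkℚᵘ z 0
toℚᵘ-ℤ→ℚ z = toℚᵘ-fromℚᵘ (ℚᵘ.mkℚᵘ z 0)

ℤ→ℚ-+ : ∀ a b → ℤ→ℚ (a ℤ.+ b) ≡ ℤ→ℚ a + ℤ→ℚ b
ℤ→ℚ-+ a b = toℚᵘ-injective (begin
  toℚᵘ (ℤ→ℚ (a ℤ.+ b))            ≈⟨ toℚᵘ-ℤ→ℚ (a ℤ.+ b) ⟩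
  ℚᵘ.mkℚᵘ (a ℤ.+ b) 0              ≈⟨ ℚᵘ.*≡* (cong (ℤ._* + 1) (cong₂ ℤ._+_ (ℤ.*-identityʳ a) (ℤ.*-identityʳ b))) ⟨
  ℚᵘ.mkℚᵘ a 0 ℚᵘ.+ ℚᵘ.mkℚᵘ b 0    ≈⟨ ℚᵘ.+-cong (toℚᵘ-ℤ→ℚ a) (toℚᵘ-ℤ→ℚ b) ⟨
  toℚᵘ (ℤ→ℚ a) ℚᵘ.+ toℚᵘ (ℤ→ℚ b)  ≈⟨ toℚᵘ-homo-+ (ℤ→ℚ a) (ℤ→ℚ b) ⟨
  toℚᵘ (ℤ→ℚ a + ℤ→ℚ b)            ∎)
  where open ℚᵘ.≃-Reasoning

ℤ→ℚ-neg : ∀ a → ℤ→ℚ (ℤ.- a) ≡ - ℤ→ℚ a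
ℤ→ℚ-neg a = toℚᵘ-injective (begin
  toℚᵘ (ℤ→ℚ (ℤ.- a))     ≈⟨ toℚᵘ-ℤ→ℚ (ℤ.- a) ⟩
  ℚᵘ.mkℚᵘ (ℤ.- a) 0       ≈⟨ ℚᵘ.-‿cong (toℚᵘ-ℤ→ℚ a) ⟨
  ℚᵘ.- toℚᵘ (ℤ→ℚ a)       ≈⟨ toℚᵘ-homo‿- (ℤ→ℚ a) ⟨
  toℚᵘ (- ℤ→ℚ a)          ∎)
  where open ℚᵘ.≃-Reasoning

ℤ→ℚ-mono-≤ : ∀ {a b} → a ℤ.≤ b → ℤ→ℚ a ≤ ℤ→ℚ b
ℤ→ℚ-mono-≤ {a} {b} a≤b = toℚᵘ-cancel-≤ (begin
  toℚᵘ (ℤ→ℚ a)   ≃⟨ toℚᵘ-ℤ→ℚ a ⟩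
  ℚᵘ.mkℚᵘ a 0     ≤⟨ ℚᵘ.*≤* (subst₂ ℤ._≤_ (sym (ℤ.*-identityʳ a)) (sym (ℤ.*-identityʳ b)) a≤b) ⟩
  ℚᵘ.mkℚᵘ b 0     ≃⟨ toℚᵘ-ℤ→ℚ b ⟨
  toℚᵘ (ℤ→ℚ b)   ∎)
  where open ℚᵘ.≤-Reasoning

ℤ→ℚ-injective : ∀ {a b} → ℤ→ℚ a ≡ ℤ→ℚ b → a ≡ b
ℤ→ℚ-injective {a} {b} eq
  with ℚᵘ.≃-trans (ℚᵘ.≃-sym (toℚᵘ-ℤ→ℚ a)) (ℚᵘ.≃-trans (toℚᵘ-cong eq) (toℚᵘ-ℤ→ℚ b))
... | ℚᵘ.*≡* a*1≡b*1 = trans (sym (ℤ.*-identityʳ a)) (trans a*1≡b*1 (ℤ.*-identityʳ b))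

ℤ→ℚ-- : ∀ a b → ℤ→ℚ (a ℤ.- b) ≡ ℤ→ℚ a - ℤ→ℚ b
ℤ→ℚ-- a b = trans (ℤ→ℚ-+ a (ℤ.- b)) (cong (_+_ (ℤ→ℚ a)) (ℤ→ℚ-neg b))

ℕ→ℚ-+ : ∀ a b → ℕ→ℚ (a ℕ.+ b) ≡ ℕ→ℚ a + ℕ→ℚ b
ℕ→ℚ-+ a b = ℤ→ℚ-+ (+ a) (+ b)

ℕ→ℚ-suc : ∀ a → ℕ→ℚ (suc a) ≡ ℕ→ℚ a + 1ℚ
ℕ→ℚ-suc a = trans (cong ℕ→ℚ (ℕ.+-comm 1 a)) (ℕ→ℚ-+ a 1)

ℕ→ℚ-mono-≤ : ∀ {a b} → a ℕ.≤ b → ℕ→ℚ a ≤ ℕ→ℚ b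
ℕ→ℚ-mono-≤ a≤b = ℤ→ℚ-mono-≤ (ℤ.+≤+ a≤b)

+-cancelˡ-≤ : ∀ x {y z} → x + y ≤ x + z → y ≤ z
+-cancelˡ-≤ x {y} {z} x+y≤x+z = subst₂ _≤_ (lemma y) (lemma z) (+-monoʳ-≤ (- x) x+y≤x+z)
  where
  lemma : ∀ y → - x + (x + y) ≡ y
  lemma = solve 2 (λ x y → :- x :+ (x :+ y) := y) refl x

p<q⇒0<q-p : ∀ {p q} → p < q → 0ℚ < q - p
p<q⇒0<q-p {p} {q} h = subst (_< q - p) (+-inverseʳ p) (+-monoˡ-< (- p) h)

p+q≤r+s⇒p-r≤s-q : ∀ {p q r s} → p + q ≤ r + s → p - r ≤ s - q
p+q≤r+s⇒p-r≤s-q {p} {q} {r} {s} p+q≤r+s = subst₂ _≤_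
  (solve 4 (λ p q r s → (p :+ q) :+ (:- r :- q) := p :- r) refl p q r s)
  (solve 4 (λ p q r s → (r :+ s) :+ (:- r :- q) := s :- q) refl p q r s)
  (+-monoˡ-≤ (- r - q) p+q≤r+s)

p<q-r⇒r<q-p : ∀ {p q r} → p < q - r → r < q - p
p<q-r⇒r<q-p {p} {q} {r} p<q-r = subst₂ _<_
  (solve 3 (λ p q r → p :+ (r :- p) := r) refl p q r)
  (solve 3 (λ p q r → (q :- r) :+ (r :- p) := q :- p) refl p q r)
  (+-monoˡ-< (r - p) p<q-r)

0<1 : 0ℚ < 1ℚ
0<1 = toWitness {a? = 0ℚ <? 1ℚ} tt

infix 4 _≐_ _∋ᵇ_

_≐_ : ∀ {n} → Subset n → Subset n → Set
A ≐ B = ∀ j → A j ≡ B j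

⟦_⟧ : Bool → ℚ
⟦ b ⟧ = if b then 1ℚ else 0ℚ

Σℚ-cong : ∀ n {f g : Fin n → ℚ} → (∀ i → f i ≡ g i) → Σℚ n f ≡ Σℚ n g
Σℚ-cong zero    f≡g = refl
Σℚ-cong (suc n) f≡g = cong₂ _+_ (f≡g zero) (Σℚ-cong n (f≡g ∘ suc))

Σℚ-zero : ∀ n {f : Fin n → ℚ} → (∀ i → f i ≡ 0ℚ) → Σℚ n f ≡ 0ℚ
Σℚ-zero zero    f≡0 = refl
Σℚ-zero (suc n) f≡0 = trans (cong₂ _+_ (f≡0 zero) (Σℚ-zero n (f≡0 ∘ suc))) (+-identityˡ 0ℚ)

Σℚ-+ : ∀ n (f g : Fin n → ℚ) → Σℚ n (λ i → f i + g i) ≡ Σℚ n f + Σℚ n g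
Σℚ-+ zero    f g = refl
Σℚ-+ (suc n) f g = trans (cong (_+_ (f zero + g zero)) (Σℚ-+ n (f ∘ suc) (g ∘ suc)))
  (solve 4 (λ a b c d → (a :+ b) :+ (c :+ d) := (a :+ c) :+ (b :+ d)) refl
    (f zero) (g zero) (Σℚ n (f ∘ suc)) (Σℚ n (g ∘ suc)))

Σℚ-*ˡ : ∀ n c (f : Fin n → ℚ) → Σℚ n (λ i → c * f i) ≡ c * Σℚ n f
Σℚ-*ˡ zero    c f = sym (*-zeroʳ c)
Σℚ-*ˡ (suc n) c f =
  trans (cong (_+_ (c * f zero)) (Σℚ-*ˡ n c (f ∘ suc))) (sym (*-distribˡ-+ c _ _))

Σℚ-neg : ∀ n (f : Fin n → ℚ) → Σℚ n (λ i → - f i) ≡ - Σℚ n f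
Σℚ-neg zero    f = refl
Σℚ-neg (suc n) f =
  trans (cong (_+_ (- f zero)) (Σℚ-neg n (f ∘ suc))) (sym (neg-distrib-+ (f zero) _))

Σℚ-- : ∀ n (f g : Fin n → ℚ) → Σℚ n (λ i → f i - g i) ≡ Σℚ n f - Σℚ n g
Σℚ-- n f g = trans (Σℚ-+ n f (λ i → - g i)) (cong (_+_ (Σℚ n f)) (Σℚ-neg n g))

Σℚ-mono-≤ : ∀ n {f g : Fin n → ℚ} → (∀ i → f i ≤ g i) → Σℚ n f ≤ Σℚ n g
Σℚ-mono-≤ zero    f≤g = ≤-refl
Σℚ-mono-≤ (suc n) f≤g = +-mono-≤ (f≤g zero) (Σℚ-mono-≤ n (f≤g ∘ suc))

Σℚ-comm : ∀ n m (f : Fin n → Fin m → ℚ) →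
  Σℚ n (λ i → Σℚ m (f i)) ≡ Σℚ m (λ j → Σℚ n (λ i → f i j))
Σℚ-comm zero    m f = sym (Σℚ-zero m (λ _ → refl))
Σℚ-comm (suc n) m f = trans (cong (_+_ (Σℚ m (f zero))) (Σℚ-comm n m (f ∘ suc)))
  (sym (Σℚ-+ m (f zero) (λ j → Σℚ n (λ i → f (suc i) j))))

Σℚ-pick : ∀ n (f : Fin n → ℚ) (k : Fin n) →
  Σℚ n (λ j → if toℕ j ≡ᵇ toℕ k then f j else 0ℚ) ≡ f k
Σℚ-pick (suc n) f zero    = trans (cong (_+_ (f zero)) (Σℚ-zero n (λ _ → refl))) (+-identityʳ _)
Σℚ-pick (suc n) f (suc k) = trans (+-identityˡ _) (Σℚ-pick n (f ∘ suc) k)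

ΣOver-congˡ : ∀ {n} {A B : Subset n} (f : Fin n → ℚ) → A ≐ B → ΣOver A f ≡ ΣOver B f
ΣOver-congˡ {n} f A≐B = Σℚ-cong n (λ k → cong (if_then f k else 0ℚ) (A≐B k))

ΣOver-congʳ : ∀ {n} (A : Subset n) {f g : Fin n → ℚ} → (∀ k → f k ≡ g k) → ΣOver A f ≡ ΣOver A g
ΣOver-congʳ {n} A f≡g = Σℚ-cong n (λ k → cong (λ x → if A k then x else 0ℚ) (f≡g k))

ΣOver-∪-∩ : ∀ {n} (A B : Subset n) (v : Fin n → ℚ) →
  ΣOver (A ∪ B) v + ΣOver (A ∩ B) v ≡ ΣOver A v + ΣOver B v
ΣOver-∪-∩ {n} A B v = begin
  ΣOver (A ∪ B) v + ΣOver (A ∩ B) v  ≡⟨ Σℚ-+ n _ _ ⟨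
  Σℚ n (λ j → at (A j ∨ B j) j + at (A j ∧ B j) j)
    ≡⟨ Σℚ-cong n (λ j → pointwise (A j) (B j) (v j)) ⟩
  Σℚ n (λ j → at (A j) j + at (B j) j)  ≡⟨ Σℚ-+ n _ _ ⟩
  ΣOver A v + ΣOver B v  ∎
  where
  open ≡-Reasoning
  at : Bool → Fin n → ℚ
  at b j = if b then v j else 0ℚ
  pointwise : ∀ a b x → (if a ∨ b then x else 0ℚ) + (if a ∧ b then x else 0ℚ)
                      ≡ (if a then x else 0ℚ) + (if b then x else 0ℚ)
  pointwise true  true  x = refl
  pointwise true  false x = refl
  pointwise false true  x = +-comm x 0ℚ
  pointwise false false x = refl

ΣOver-zero : ∀ {n} (A : Subset n) → ΣOver A (λ _ → 0ℚ) ≡ 0ℚ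
ΣOver-zero {n} A = Σℚ-zero n (λ k → if-eta (A k))

ΣOver-+ : ∀ {n} (A : Subset n) (f g : Fin n → ℚ) →
  ΣOver A (λ k → f k + g k) ≡ ΣOver A f + ΣOver A g
ΣOver-+ {n} A f g = trans (Σℚ-cong n (λ k → split (A k) (f k) (g k))) (Σℚ-+ n _ _)
  where
  split : ∀ b x y → (if b then x + y else 0ℚ) ≡ (if b then x else 0ℚ) + (if b then y else 0ℚ)
  split true  x y = refl
  split false x y = sym (+-identityˡ 0ℚ)

ΣOver-- : ∀ {n} (A : Subset n) (f g : Fin n → ℚ) →
  ΣOver A (λ k → f k - g k) ≡ ΣOver A f - ΣOver A g
ΣOver-- {n} A f g = trans (Σℚ-cong n (λ k → split (A k) (f k) (g k))) (Σℚ-- n _ _)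
  where
  split : ∀ b x y → (if b then x - y else 0ℚ) ≡ (if b then x else 0ℚ) - (if b then y else 0ℚ)
  split true  x y = refl
  split false x y = sym (+-inverseʳ 0ℚ)

ΣOver-*ˡ : ∀ {n} (A : Subset n) c (f : Fin n → ℚ) → ΣOver A (λ k → c * f k) ≡ c * ΣOver A f
ΣOver-*ˡ {n} A c f = trans (Σℚ-cong n (λ k → split (A k) (f k))) (Σℚ-*ˡ n c _)
  where
  split : ∀ b x → (if b then c * x else 0ℚ) ≡ c * (if b then x else 0ℚ)
  split true  x = refl
  split false x = sym (*-zeroʳ c)

ΣOver-Σℚ-comm : ∀ {n} (A : Subset n) m (f : Fin m → Fin n → ℚ) →
  ΣOver A (λ k → Σℚ m (λ i → f i k)) ≡ Σℚ m (λ i → ΣOver A (f i))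
ΣOver-Σℚ-comm {n} A m f =
  trans (Σℚ-cong n (λ k → split (A k) (λ i → f i k))) (Σℚ-comm n m (λ k i → if A k then f i k else 0ℚ))
  where
  split : ∀ b (g : Fin m → ℚ) → (if b then Σℚ m g else 0ℚ) ≡ Σℚ m (λ i → if b then g i else 0ℚ)
  split true  g = refl
  split false g = sym (Σℚ-zero m (λ _ → refl))

infixr 5 _◂_

_◂_ : ∀ {n} → Bool → Subset n → Subset (suc n)
(b ◂ A) zero    = b
(b ◂ A) (suc k) = A k

◂-η : ∀ {n} (A : Subset (suc n)) → A zero ◂ (A ∘ suc) ≐ A
◂-η A zero    = refl
◂-η A (suc k) = refl

◂-cong : ∀ {n} b {A B : Subset n} → A ≐ B → b ◂ A ≐ b ◂ B
◂-cong b A≐B zero    = refl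
◂-cong b A≐B (suc k) = A≐B k

-- Subsets are functions, so without function extensionality enumerating them only works up to ≐.
Respects≐ : ∀ {n} → (Subset n → Set) → Set
Respects≐ {n} P = ∀ {A B : Subset n} → A ≐ B → P A → P B

∀⊎∃¬ : ∀ n {P : Subset n → Set} → Respects≐ P → (∀ A → Dec (P A)) →
  (∀ A → P A) ⊎ ∃ λ A → ¬ P A
∀⊎∃¬ zero resp P? with P? ∅
... | yes p = inj₁ (λ A → resp (λ ()) p)
... | no ¬p = inj₂ (∅ , ¬p)
∀⊎∃¬ (suc n) {P} resp P?
  with ∀⊎∃¬ n (λ A≐B → resp (◂-cong false A≐B)) (λ A → P? (false ◂ A))
     | ∀⊎∃¬ n (λ A≐B → resp (◂-cong true A≐B)) (λ A → P? (true ◂ A))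
... | inj₂ (A , ¬p) | _             = inj₂ (false ◂ A , ¬p)
... | inj₁ _        | inj₂ (A , ¬p) = inj₂ (true ◂ A , ¬p)
... | inj₁ p₀       | inj₁ p₁       = inj₁ (λ A → resp (◂-η A) (split (A zero) (A ∘ suc)))
  where
  split : ∀ b A → P (b ◂ A)
  split false = p₀
  split true  = p₁

positive-lower-bound : ∀ n (s : Subset n → ℚ) → (∀ {A B} → A ≐ B → s A ≡ s B) →
  (∀ A → 0ℚ < s A) → ∃ λ e → 0ℚ < e × (∀ A → e ≤ s A)
positive-lower-bound zero s s-cong 0<s = s ∅ , 0<s ∅ , λ A → ≤-reflexive (s-cong (λ ()))
positive-lower-bound (suc n) s s-cong 0<s
  with positive-lower-bound n (λ A → s (false ◂ A)) (λ A≐B → s-cong (◂-cong false A≐B)) (λ A → 0<s (false ◂ A))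
     | positive-lower-bound n (λ A → s (true ◂ A)) (λ A≐B → s-cong (◂-cong true A≐B)) (λ A → 0<s (true ◂ A))
... | e₀ , 0<e₀ , e₀≤s | e₁ , 0<e₁ , e₁≤s =
  e₀ ⊓ e₁ , 0<e₀⊓e₁ , λ A → subst (e₀ ⊓ e₁ ≤_) (s-cong (◂-η A)) (split (A zero) (A ∘ suc))
  where
  0<e₀⊓e₁ : 0ℚ < e₀ ⊓ e₁
  0<e₀⊓e₁ = [ (λ eq → subst (0ℚ <_) (sym eq) 0<e₀) , (λ eq → subst (0ℚ <_) (sym eq) 0<e₁) ]′ (⊓-sel e₀ e₁)
  split : ∀ b A → e₀ ⊓ e₁ ≤ s (b ◂ A)
  split false A = ≤-trans (p⊓q≤p e₀ e₁) (e₀≤s A)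
  split true  A = ≤-trans (p⊓q≤q e₀ e₁) (e₁≤s A)

∃⊎∀ : ∀ {n} {P Q : Fin n → Set} → (∀ j → P j ⊎ Q j) → ∃ P ⊎ (∀ j → Q j)
∃⊎∀ {zero}  P⊎Q = inj₂ (λ ())
∃⊎∀ {suc n} P⊎Q with P⊎Q zero | ∃⊎∀ (P⊎Q ∘ suc)
... | inj₁ p | _            = inj₁ (zero , p)
... | inj₂ _ | inj₁ (j , p) = inj₁ (suc j , p)
... | inj₂ q | inj₂ qs      = inj₂ (λ { zero → q ; (suc j) → qs j })

-- Membership of a natural-number index; indices beyond the ground set are never members.
_∋ᵇ_ : ∀ {n} → Subset n → ℕ → Bool
_∋ᵇ_ {zero}  A a       = false
_∋ᵇ_ {suc n} A zero    = A zero
_∋ᵇ_ {suc n} A (suc a) = (A ∘ suc) ∋ᵇ a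

∋ᵇ-toℕ : ∀ {n} (A : Subset n) (k : Fin n) → (A ∋ᵇ toℕ k) ≡ A k
∋ᵇ-toℕ A zero    = refl
∋ᵇ-toℕ A (suc k) = ∋ᵇ-toℕ (A ∘ suc) k

∋ᵇ-prefix : ∀ {n m} → m ℕ.≤ n → ∀ a → (prefix {n} m ∋ᵇ a) ≡ (a <ᵇ m)
∋ᵇ-prefix {zero}  z≤n       a       = refl
∋ᵇ-prefix {suc n} _         zero    = refl
∋ᵇ-prefix {suc n} z≤n       (suc a) = ∋ᵇ-prefix {n} z≤n a
∋ᵇ-prefix {suc n} (s≤s m≤n) (suc a) = ∋ᵇ-prefix m≤n a

∋ᵇ-full : ∀ {n} a → (full {n} ∋ᵇ a) ≡ (a <ᵇ n)
∋ᵇ-full {zero}  a       = refl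
∋ᵇ-full {suc n} zero    = refl
∋ᵇ-full {suc n} (suc a) = ∋ᵇ-full {n} a

ΣOver-δ : ∀ {n} (A : Subset n) a → ΣOver A (λ j → δ (toℕ j) a) ≡ ⟦ A ∋ᵇ a ⟧
ΣOver-δ {zero}  A a = refl
ΣOver-δ {suc n} A zero with A zero
... | true  = trans (cong (_+_ 1ℚ) (ΣOver-zero (A ∘ suc))) (+-identityʳ 1ℚ)
... | false = trans (+-identityˡ _) (ΣOver-zero (A ∘ suc))
ΣOver-δ {suc n} A (suc a) =
  trans (cong₂ _+_ (if-eta (A zero)) (ΣOver-δ (A ∘ suc) a)) (+-identityˡ _)

ΣOver-gen : ∀ {n} (A : Subset n) (k : Fin n) →
  ΣOver A (gen k) ≡ ⟦ A k ⟧ - ⟦ A ∋ᵇ suc (toℕ k) ⟧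
ΣOver-gen A k = trans (ΣOver-- A _ _)
  (cong₂ _-_ (trans (ΣOver-δ A (toℕ k)) (cong ⟦_⟧ (∋ᵇ-toℕ A k))) (ΣOver-δ A (suc (toℕ k))))

-- A comparison view recording the boolean tests, so that `rewrite` can evaluate `prefix` and `δ`.
data Compareᵇ (x y : ℕ) : Set where
  less    : (x <ᵇ y) ≡ true → (x <ᵇ suc y) ≡ true → (x ≡ᵇ y) ≡ false → Compareᵇ x y
  equal   : x ≡ y → (x <ᵇ y) ≡ false → (x <ᵇ suc y) ≡ true → (x ≡ᵇ y) ≡ true → Compareᵇ x y
  greater : (x <ᵇ y) ≡ false → (x <ᵇ suc y) ≡ false → (x ≡ᵇ y) ≡ false → Compareᵇ x y

compareᵇ : ∀ x y → Compareᵇ x y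
compareᵇ zero    zero    = equal refl refl refl refl
compareᵇ zero    (suc y) = less refl refl refl
compareᵇ (suc x) zero    = greater refl refl refl
compareᵇ (suc x) (suc y) with compareᵇ x y
... | less    x<y x<1+y x≢y       = less x<y x<1+y x≢y
... | equal   x≡y x≮y x<1+y x≡ᵇy  = equal (cong suc x≡y) x≮y x<1+y x≡ᵇy
... | greater x≮y x≮1+y x≢y       = greater x≮y x≮1+y x≢y

<ᵇ≡false⇒<ᵇsuc : ∀ {x y} → (x <ᵇ y) ≡ false → T (y <ᵇ suc x)
<ᵇ≡false⇒<ᵇsuc {x} {y} eq = ℕ.<⇒<ᵇ {y} {suc x} (s≤s (ℕ.≮⇒≥ (λ x<y → subst T eq (ℕ.<⇒<ᵇ x<y))))

<ᵇ-suc : ∀ x → (x <ᵇ suc x) ≡ true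
<ᵇ-suc zero    = refl
<ᵇ-suc (suc x) = <ᵇ-suc x

<⇒<ᵇsuc≡false : ∀ {x y} → y ℕ.< x → (x <ᵇ suc y) ≡ false
<⇒<ᵇsuc≡false {suc x} {zero}  (s≤s z≤n) = refl
<⇒<ᵇsuc≡false {suc x} {suc y} (s≤s y<x) = <⇒<ᵇsuc≡false y<x

prefix-full : ∀ {n} → prefix n ≐ full {n}
prefix-full zero    = refl
prefix-full (suc k) = prefix-full k

module _ {n} (A : Subset n) (k : Fin n) where

  prefix-∪-∩prefix : A k ≡ true →
    prefix (toℕ k) ∪ (A ∩ prefix (suc (toℕ k))) ≐ prefix (suc (toℕ k))
  prefix-∪-∩prefix k∈A j with compareᵇ (toℕ j) (toℕ k)
  ... | less    j<k j<1+k _ rewrite j<k | j<1+k = refl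
  ... | equal j≡k j≮k j<1+k _ rewrite j≮k | j<1+k | toℕ-injective {i = j} {j = k} j≡k | k∈A = refl
  ... | greater j≮k j≮1+k _ rewrite j≮k | j≮1+k = ∧-zeroʳ (A j)

  prefix-∩-∩prefix : prefix (toℕ k) ∩ (A ∩ prefix (suc (toℕ k))) ≐ A ∩ prefix (toℕ k)
  prefix-∩-∩prefix j with compareᵇ (toℕ j) (toℕ k)
  ... | less    j<k j<1+k _   rewrite j<k | j<1+k = refl
  ... | equal _ j≮k _ _      rewrite j≮k = sym (∧-zeroʳ (A j))
  ... | greater j≮k _ _      rewrite j≮k = sym (∧-zeroʳ (A j))

  ∩prefix-suc : A k ≡ false → A ∩ prefix (suc (toℕ k)) ≐ A ∩ prefix (toℕ k)
  ∩prefix-suc k∉A j with compareᵇ (toℕ j) (toℕ k)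
  ... | less    j<k j<1+k _ rewrite j<k | j<1+k = refl
  ... | equal j≡k j≮k j<1+k _ rewrite j≮k | j<1+k | toℕ-injective {i = j} {j = k} j≡k | k∉A = refl
  ... | greater j≮k j≮1+k _ rewrite j≮k | j≮1+k = refl

-- Written so that interval 0 m reduces to prefix m.
interval : ∀ {n} → ℕ → ℕ → Subset n
interval i j k = not (toℕ k <ᵇ i) ∧ (toℕ k <ᵇ j)

ΣOver-interval-telescope : ∀ n (F : ℕ → ℚ) {i j} → i ℕ.≤ j → j ℕ.≤ n →
  ΣOver {n} (interval i j) (λ k → F (suc (toℕ k)) - F (toℕ k)) ≡ F j - F i
ΣOver-interval-telescope zero    F z≤n z≤n = sym (+-inverseʳ (F 0))
ΣOver-interval-telescope (suc n) F {zero} {zero} z≤n _ =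
  trans (+-identityˡ _) (trans (Σℚ-zero n (λ _ → refl)) (sym (+-inverseʳ (F 0))))
ΣOver-interval-telescope (suc n) F {zero} {suc j} z≤n (s≤s j≤n) =
  trans (cong (_+_ (F 1 - F 0)) (ΣOver-interval-telescope n (F ∘ suc) z≤n j≤n))
    (solve 3 (λ a b c → (b :- a) :+ (c :- b) := c :- a) refl (F 0) (F 1) (F (suc j)))
ΣOver-interval-telescope (suc n) F {suc i} {suc j} (s≤s i≤j) (s≤s j≤n) =
  trans (+-identityˡ _) (ΣOver-interval-telescope n (F ∘ suc) i≤j j≤n)

Σℚ-telescope : ∀ n (F : ℕ → ℚ) → Σℚ n (λ k → F (suc (toℕ k)) - F (toℕ k)) ≡ F n - F 0
Σℚ-telescope n F = trans
  (ΣOver-congˡ {n} {full} (λ k → F (suc (toℕ k)) - F (toℕ k)) (λ k → sym (prefix-full k)))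
  (ΣOver-interval-telescope n F z≤n ℕ.≤-refl)

translate : ∀ {n} → (Fin n → ℚ) → ℚ → (Fin n → ℚ) → Fin n → ℚ
translate {n} v ε t j = v j + ε * Σℚ n (λ i → t i * gen i j)

-- The sum over A of the direction vector Σᵢ tᵢ (eᵢ - eᵢ₊₁).
slope : ∀ {n} → Subset n → (Fin n → ℚ) → ℚ
slope {n} A t = Σℚ n (λ i → t i * (⟦ A i ⟧ - ⟦ A ∋ᵇ suc (toℕ i) ⟧))

ΣOver-translate : ∀ {n} (A : Subset n) v ε (t : Fin n → ℚ) →
  ΣOver A (translate v ε t) ≡ ΣOver A v + ε * slope A t
ΣOver-translate {n} A v ε t = begin
  ΣOver A (translate v ε t)
    ≡⟨ ΣOver-+ A v _ ⟩
  ΣOver A v + ΣOver A (λ j → ε * Σℚ n (λ i → t i * gen i j))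
    ≡⟨ cong (_+_ (ΣOver A v)) (ΣOver-*ˡ A ε _) ⟩
  ΣOver A v + ε * ΣOver A (λ j → Σℚ n (λ i → t i * gen i j))
    ≡⟨ cong (λ x → ΣOver A v + ε * x) (ΣOver-Σℚ-comm A n (λ i j → t i * gen i j)) ⟩
  ΣOver A v + ε * Σℚ n (λ i → ΣOver A (λ j → t i * gen i j))
    ≡⟨ cong (λ x → ΣOver A v + ε * x) (Σℚ-cong n termwise) ⟩
  ΣOver A v + ε * slope A t  ∎
  where
  open ≡-Reasoning
  termwise : ∀ i → ΣOver A (λ j → t i * gen i j) ≡ t i * (⟦ A i ⟧ - ⟦ A ∋ᵇ suc (toℕ i) ⟧)
  termwise i = trans (ΣOver-*ˡ A (t i) (gen i)) (cong (t i *_) (ΣOver-gen A i))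

slope-prefix : ∀ {n} (t : Fin n → ℚ) (k : Fin n) → slope (prefix (suc (toℕ k))) t ≡ t k
slope-prefix {n} t k = trans (Σℚ-cong n term) (Σℚ-pick n t k)
  where
  term : ∀ i → t i * (⟦ prefix (suc (toℕ k)) i ⟧ - ⟦ prefix {n} (suc (toℕ k)) ∋ᵇ suc (toℕ i) ⟧)
             ≡ (if toℕ i ≡ᵇ toℕ k then t i else 0ℚ)
  term i rewrite ∋ᵇ-prefix {n} {suc (toℕ k)} (toℕ<n k) (suc (toℕ i)) with compareᵇ (toℕ i) (toℕ k)
  ... | less    i<k i<1+k i≢k  rewrite i<k | i<1+k | i≢k = *-zeroʳ (t i)
  ... | equal _ i≮k i<1+k i≡k  rewrite i≮k | i<1+k | i≡k = *-identityʳ (t i)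
  ... | greater i≮k i≮1+k i≢k rewrite i≮k | i≮1+k | i≢k = *-zeroʳ (t i)

-- Only the generators eᵢ - eᵢ₊₁ with i + 1 < n span Δ.
Supported : ∀ {n} → (Fin n → ℚ) → Set
Supported {n} t = ∀ i → T (n <ᵇ suc (suc (toℕ i))) → t i ≡ 0ℚ

slope-full : ∀ {n} (t : Fin n → ℚ) → Supported t → slope full t ≡ 0ℚ
slope-full {n} t supported = Σℚ-zero n term
  where
  term : ∀ i → t i * (1ℚ - ⟦ full {n} ∋ᵇ suc (toℕ i) ⟧) ≡ 0ℚ
  term i rewrite ∋ᵇ-full {n} (suc (toℕ i)) with suc (toℕ i) <ᵇ n in 1+i≮n
  ... | true  = *-zeroʳ (t i)
  ... | false rewrite supported i (<ᵇ≡false⇒<ᵇsuc {suc (toℕ i)} {n} 1+i≮n) = *-zeroˡ 1ℚ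

Σℚ-translate : ∀ {n} (v : Fin n → ℚ) ε (t : Fin n → ℚ) → Supported t →
  Σℚ n (translate v ε t) ≡ Σℚ n v
Σℚ-translate {n} v ε t supported = begin
  ΣOver full (translate v ε t)  ≡⟨ ΣOver-translate full v ε t ⟩
  Σℚ n v + ε * slope full t     ≡⟨ cong (λ x → Σℚ n v + ε * x) (slope-full t supported) ⟩
  Σℚ n v + ε * 0ℚ               ≡⟨ cong (_+_ (Σℚ n v)) (*-zeroʳ ε) ⟩
  Σℚ n v + 0ℚ                   ≡⟨ +-identityʳ _ ⟩
  Σℚ n v                        ∎
  where open ≡-Reasoning

slope-≥-1 : ∀ {n} (A : Subset n) (t : Fin n → ℚ) → (∀ i → 0ℚ ≤ t i) → Σℚ n t ≡ 1ℚ →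
  - 1ℚ ≤ slope A t
slope-≥-1 {n} A t t≥0 Σt≡1 = begin
  - 1ℚ                     ≡⟨ cong (- 1ℚ *_) Σt≡1 ⟨
  - 1ℚ * Σℚ n t            ≡⟨ Σℚ-*ˡ n (- 1ℚ) t ⟨
  Σℚ n (λ i → - 1ℚ * t i)  ≤⟨ Σℚ-mono-≤ n term ⟩
  slope A t                ∎
  where
  open ≤-Reasoning
  difference-≥-1 : ∀ a b → - 1ℚ ≤ ⟦ a ⟧ - ⟦ b ⟧
  difference-≥-1 true  true  = toWitness {a? = - 1ℚ ≤? 1ℚ - 1ℚ} tt
  difference-≥-1 true  false = toWitness {a? = - 1ℚ ≤? 1ℚ - 0ℚ} tt
  difference-≥-1 false true  = ≤-refl
  difference-≥-1 false false = toWitness {a? = - 1ℚ ≤? 0ℚ - 0ℚ} tt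
  term : ∀ i → - 1ℚ * t i ≤ t i * (⟦ A i ⟧ - ⟦ A ∋ᵇ suc (toℕ i) ⟧)
  term i = subst (_≤ t i * (⟦ A i ⟧ - ⟦ A ∋ᵇ suc (toℕ i) ⟧)) (*-comm (t i) (- 1ℚ))
    (*-monoˡ-≤-nonNeg (t i) {{nonNegative (t≥0 i)}} (difference-≥-1 (A i) _))

slope-interval : ∀ {n} (A : Subset n) (c : ℚ) {i j : Fin n} → toℕ i ℕ.≤ toℕ j →
  slope A (λ k → if interval (toℕ i) (toℕ j) k then c else 0ℚ) ≡ c * (⟦ A i ⟧ - ⟦ A j ⟧)
slope-interval {n} A c {i} {j} i≤j = begin
  slope A (λ k → if interval (toℕ i) (toℕ j) k then c else 0ℚ)
    ≡⟨ Σℚ-cong n (λ k → term k (I k)) ⟩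
  ΣOver I (λ k → c * (F (suc (toℕ k)) - F (toℕ k)))
    ≡⟨ ΣOver-*ˡ I c _ ⟩
  c * ΣOver I (λ k → F (suc (toℕ k)) - F (toℕ k))
    ≡⟨ cong (c *_) (ΣOver-interval-telescope n F i≤j (ℕ.<⇒≤ (toℕ<n j))) ⟩
  c * (F (toℕ j) - F (toℕ i))
    ≡⟨ cong (c *_) (solve 2 (λ a b → (:- b) :- (:- a) := a :- b) refl ⟦ A ∋ᵇ toℕ i ⟧ ⟦ A ∋ᵇ toℕ j ⟧) ⟩
  c * (⟦ A ∋ᵇ toℕ i ⟧ - ⟦ A ∋ᵇ toℕ j ⟧)
    ≡⟨ cong₂ (λ a b → c * (⟦ a ⟧ - ⟦ b ⟧)) (∋ᵇ-toℕ A i) (∋ᵇ-toℕ A j) ⟩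
  c * (⟦ A i ⟧ - ⟦ A j ⟧)  ∎
  where
  open ≡-Reasoning
  I : Subset n
  I = interval (toℕ i) (toℕ j)
  F : ℕ → ℚ
  F a = - ⟦ A ∋ᵇ a ⟧
  term : ∀ k b → (if b then c else 0ℚ) * (⟦ A k ⟧ - ⟦ A ∋ᵇ suc (toℕ k) ⟧)
               ≡ (if b then c * (F (suc (toℕ k)) - F (toℕ k)) else 0ℚ)
  term k true  = cong (c *_) (trans (cong (λ a → ⟦ a ⟧ - ⟦ A ∋ᵇ suc (toℕ k) ⟧) (sym (∋ᵇ-toℕ A k)))
    (solve 2 (λ a b → a :- b := (:- b) :- (:- a)) refl ⟦ A ∋ᵇ toℕ k ⟧ ⟦ A ∋ᵇ suc (toℕ k) ⟧))
  term k false = *-zeroˡ (⟦ A k ⟧ - ⟦ A ∋ᵇ suc (toℕ k) ⟧)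

rvecℚ : ∀ {n} → (Subset n → ℕ) → Fin n → ℚ
rvecℚ rk k = ℤ→ℚ (rvec rk k)

rvecℚ-prefix : ∀ {n} (rk : Subset n → ℕ) k →
  rvecℚ rk k ≡ ℕ→ℚ (rk (prefix (suc (toℕ k)))) - ℕ→ℚ (rk (prefix (toℕ k)))
rvecℚ-prefix rk k = ℤ→ℚ-- (+ rk (prefix (suc (toℕ k)))) (+ rk (prefix (toℕ k)))

Tight : ∀ {n} → (Subset n → ℕ) → (Fin n → ℚ) → Subset n → Set
Tight rk v A = ΣOver A v ≡ ℕ→ℚ (rk A)

⋂ : ∀ {m n} → (Fin m → Subset n) → Subset n
⋂ {zero}  W = full
⋂ {suc m} W = W zero ∩ ⋂ (W ∘ suc)

∈-⋂ : ∀ {m n} (W : Fin m → Subset n) k → (∀ j → W j k ≡ true) → ⋂ W k ≡ true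
∈-⋂ {zero}  W k k∈W = refl
∈-⋂ {suc m} W k k∈W rewrite k∈W zero = ∈-⋂ (W ∘ suc) k (k∈W ∘ suc)

∉-⋂ : ∀ {m n} (W : Fin m → Subset n) k j → W j k ≡ false → ⋂ W k ≡ false
∉-⋂ W k zero    k∉Wj rewrite k∉Wj = refl
∉-⋂ W k (suc j) k∉Wj = trans (cong (W zero k ∧_) (∉-⋂ (W ∘ suc) k j k∉Wj)) (∧-zeroʳ (W zero k))

module _ {n} {rk : Subset n → ℕ} (P : IsPolymatroid n rk) where
  open IsPolymatroid P

  rk-cong : ∀ {A B} → A ≐ B → rk A ≡ rk B
  rk-cong A≐B = ℕ.≤-antisym (monotone _ _ (λ j → subst T (A≐B j)))
                            (monotone _ _ (λ j → subst T (sym (A≐B j))))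

  ℕ→ℚ-submodular : ∀ A B →
    ℕ→ℚ (rk (A ∪ B)) + ℕ→ℚ (rk (A ∩ B)) ≤ ℕ→ℚ (rk A) + ℕ→ℚ (rk B)
  ℕ→ℚ-submodular A B = subst₂ _≤_ (ℕ→ℚ-+ (rk (A ∪ B)) (rk (A ∩ B))) (ℕ→ℚ-+ (rk A) (rk B))
    (ℕ→ℚ-mono-≤ (submodular A B))

  private
    R : ℕ → ℚ
    R m = ℕ→ℚ (rk (prefix m))

  ΣOver-prefix-rvecℚ : ∀ {m} → m ℕ.≤ n → ΣOver (prefix m) (rvecℚ rk) ≡ R m
  ΣOver-prefix-rvecℚ {m} m≤n = begin
    ΣOver (prefix m) (rvecℚ rk)
      ≡⟨ ΣOver-congʳ (prefix {n} m) (rvecℚ-prefix rk) ⟩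
    ΣOver (interval {n} 0 m) (λ k → R (suc (toℕ k)) - R (toℕ k))
      ≡⟨ ΣOver-interval-telescope n R z≤n m≤n ⟩
    R m - ℕ→ℚ (rk ∅)  ≡⟨ cong (λ x → R m - ℕ→ℚ x) rk-∅ ⟩
    R m - 0ℚ          ≡⟨ +-identityʳ (R m) ⟩
    R m               ∎
    where open ≡-Reasoning

  Σℚ-rvecℚ : Σℚ n (rvecℚ rk) ≡ ℕ→ℚ (rk full)
  Σℚ-rvecℚ = begin
    ΣOver full (rvecℚ rk)      ≡⟨ ΣOver-congˡ (rvecℚ rk) (λ k → sym (prefix-full k)) ⟩
    ΣOver (prefix n) (rvecℚ rk) ≡⟨ ΣOver-prefix-rvecℚ ℕ.≤-refl ⟩
    R n                         ≡⟨ cong ℕ→ℚ (rk-cong prefix-full) ⟩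
    ℕ→ℚ (rk full)              ∎
    where open ≡-Reasoning

  -- Submodularity as diminishing returns, applied to prefix k ⊇ A ∩ prefix k.
  rvecℚ-≤-marginal : ∀ A k → A k ≡ true →
    rvecℚ rk k ≤ ℕ→ℚ (rk (A ∩ prefix (suc (toℕ k)))) - ℕ→ℚ (rk (A ∩ prefix (toℕ k)))
  rvecℚ-≤-marginal A k k∈A = subst (_≤ ℕ→ℚ (rk Y) - ℕ→ℚ (rk (A ∩ X))) (sym (rvecℚ-prefix rk k))
    (p+q≤r+s⇒p-r≤s-q {ℕ→ℚ (rk (prefix (suc (toℕ k))))} {ℕ→ℚ (rk (A ∩ X))} submodular-X-Y)
    where
    X Y : Subset n
    X = prefix (toℕ k)
    Y = A ∩ prefix (suc (toℕ k))
    submodular-X-Y : ℕ→ℚ (rk (prefix (suc (toℕ k)))) + ℕ→ℚ (rk (A ∩ X)) ≤ ℕ→ℚ (rk X) + ℕ→ℚ (rk Y)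
    submodular-X-Y = subst₂ (λ a b → ℕ→ℚ a + ℕ→ℚ b ≤ ℕ→ℚ (rk X) + ℕ→ℚ (rk Y))
      (rk-cong (prefix-∪-∩prefix A k k∈A)) (rk-cong (prefix-∩-∩prefix A k)) (ℕ→ℚ-submodular X Y)

  ΣOver-rvecℚ-≤ : ∀ A → ΣOver A (rvecℚ rk) ≤ ℕ→ℚ (rk A)
  ΣOver-rvecℚ-≤ A = begin
    ΣOver A (rvecℚ rk)                            ≤⟨ Σℚ-mono-≤ n step ⟩
    Σℚ n (λ k → RA (suc (toℕ k)) - RA (toℕ k))   ≡⟨ Σℚ-telescope n RA ⟩
    RA n - RA 0                                   ≡⟨ cong₂ (λ x y → ℕ→ℚ x - ℕ→ℚ y)
                                                       (rk-cong A∩prefix-n) (trans (rk-cong A∩prefix-0) rk-∅) ⟩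
    ℕ→ℚ (rk A) - 0ℚ                              ≡⟨ +-identityʳ _ ⟩
    ℕ→ℚ (rk A)                                   ∎
    where
    open ≤-Reasoning
    RA : ℕ → ℚ
    RA m = ℕ→ℚ (rk (A ∩ prefix m))
    A∩prefix-n : A ∩ prefix n ≐ A
    A∩prefix-n j = trans (cong (A j ∧_) (prefix-full j)) (∧-identityʳ (A j))
    A∩prefix-0 : A ∩ prefix 0 ≐ ∅
    A∩prefix-0 j = ∧-zeroʳ (A j)
    step : ∀ k → (if A k then rvecℚ rk k else 0ℚ) ≤ RA (suc (toℕ k)) - RA (toℕ k)
    step k with A k in k∈A
    ... | true  = rvecℚ-≤-marginal A k k∈A
    ... | false = ≤-reflexive (sym (trans (cong (λ x → ℕ→ℚ x - RA (toℕ k)) (rk-cong (∩prefix-suc A k k∈A)))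
                                          (+-inverseʳ (RA (toℕ k)))))

  rvecℚ∈Q : rvecℚ rk ∈Q rk
  rvecℚ∈Q = Σℚ-rvecℚ , ΣOver-rvecℚ-≤

  Tight-∩ : ∀ {v A B} → (∀ C → ΣOver C v ≤ ℕ→ℚ (rk C)) →
    Tight rk v A → Tight rk v B → Tight rk v (A ∩ B)
  Tight-∩ {v} {A} {B} v≤rk tight-A tight-B = ≤-antisym (v≤rk (A ∩ B)) (+-cancelˡ-≤ (ℕ→ℚ (rk (A ∪ B))) (begin
    ℕ→ℚ (rk (A ∪ B)) + ℕ→ℚ (rk (A ∩ B))  ≤⟨ ℕ→ℚ-submodular A B ⟩
    ℕ→ℚ (rk A) + ℕ→ℚ (rk B)              ≡⟨ cong₂ _+_ tight-A tight-B ⟨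
    ΣOver A v + ΣOver B v                  ≡⟨ ΣOver-∪-∩ A B v ⟨
    ΣOver (A ∪ B) v + ΣOver (A ∩ B) v      ≤⟨ +-monoˡ-≤ (ΣOver (A ∩ B) v) (v≤rk (A ∪ B)) ⟩
    ℕ→ℚ (rk (A ∪ B)) + ΣOver (A ∩ B) v   ∎))
    where open ≤-Reasoning

  Tight-⋂ : ∀ {v} → v ∈Q rk → ∀ {m} (W : Fin m → Subset n) → (∀ j → Tight rk v (W j)) →
    Tight rk v (⋂ W)
  Tight-⋂ (Σv≡rk , _)    {zero}  W tight = Σv≡rk
  Tight-⋂ v∈Q@(_ , v≤rk) {suc m} W tight =
    Tight-∩ v≤rk (tight zero) (Tight-⋂ v∈Q (W ∘ suc) (tight ∘ suc))

MeetsQ : ∀ {n} → (Subset n → ℕ) → (Fin n → ℚ) → ℚ → Set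
MeetsQ rk v ε = ∃ λ w → InTranslatedSimplex v ε w × w ∈Q rk

Eventually : (ℚ → Set) → Set
Eventually P = Σ ℚ λ ε₀ → 0ℚ < ε₀ × (∀ ε → 0ℚ < ε → ε < ε₀ → P ε)

always⇒Eventually : ∀ {P : ℚ → Set} → (∀ ε → 0ℚ < ε → P ε) → Eventually P
always⇒Eventually p = 1ℚ , 0<1 , λ ε 0<ε _ → p ε 0<ε

Eventually-map : ∀ {P Q : ℚ → Set} → (∀ {ε} → P ε → Q ε) → Eventually P → Eventually Q
Eventually-map f (ε₀ , 0<ε₀ , p) = ε₀ , 0<ε₀ , λ ε 0<ε ε<ε₀ → f (p ε 0<ε ε<ε₀)

module _ {n} {rk : Subset n → ℕ} where

  ∈Q-cong : ∀ {u v : Fin n → ℚ} → (∀ i → u i ≡ v i) → u ∈Q rk → v ∈Q rk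
  ∈Q-cong u≐v (Σu≡rk , u≤rk) =
    trans (sym (Σℚ-cong n u≐v)) Σu≡rk , λ A → subst (_≤ ℕ→ℚ (rk A)) (ΣOver-congʳ A u≐v) (u≤rk A)

  MeetsQ-cong : ∀ {u v : Fin n → ℚ} {ε} → (∀ i → u i ≡ v i) → MeetsQ rk u ε → MeetsQ rk v ε
  MeetsQ-cong u≐v (w , (t , t≥0 , supported , Σt≡1 , w≡) , w∈Q) =
    w , (t , t≥0 , supported , Σt≡1 , λ j → trans (w≡ j) (cong (_+ _) (u≐v j))) , w∈Q

  ¬MeetsQ-Σ≢ : ∀ {v : Fin n → ℚ} ε → Σℚ n v ≢ ℕ→ℚ (rk full) → ¬ MeetsQ rk v ε
  ¬MeetsQ-Σ≢ {v} ε Σv≢rk (w , (t , _ , supported , _ , w≡) , (Σw≡rk , _)) =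
    Σv≢rk (trans (sym (Σℚ-translate v ε t supported)) (trans (sym (Σℚ-cong n w≡)) Σw≡rk))

  ¬MeetsQ-violated : ∀ {v : Fin n → ℚ} A {ε} → 0ℚ ≤ ε → ε < ΣOver A v - ℕ→ℚ (rk A) →
    ¬ MeetsQ rk v ε
  ¬MeetsQ-violated {v} A {ε} 0≤ε ε<gap (w , (t , t≥0 , _ , Σt≡1 , w≡) , (_ , w≤rk)) =
    <-irrefl refl (begin-strict
      ℕ→ℚ (rk A)                   <⟨ p<q-r⇒r<q-p {q = ΣOver A v} ε<gap ⟩
      ΣOver A v - ε                 ≤⟨ +-monoʳ-≤ (ΣOver A v) -ε≤ε*slope ⟩
      ΣOver A v + ε * slope A t     ≡⟨ ΣOver-translate A v ε t ⟨
      ΣOver A (translate v ε t)     ≡⟨ ΣOver-congʳ A w≡ ⟨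
      ΣOver A w                     ≤⟨ w≤rk A ⟩
      ℕ→ℚ (rk A)                   ∎)
    where
    open ≤-Reasoning
    -ε≤ε*slope : - ε ≤ ε * slope A t
    -ε≤ε*slope = subst (_≤ ε * slope A t) (solve 1 (λ ε → ε :* (:- con 1ℚ) := :- ε) refl ε)
      (*-monoˡ-≤-nonNeg ε {{nonNegative 0≤ε}} (slope-≥-1 A t t≥0 Σt≡1))

  -- The prefix constraints are tight at r, so every simplex direction leaves Q.
  ¬MeetsQ-rvecℚ : IsPolymatroid n rk → ∀ {ε} → 0ℚ < ε → ¬ MeetsQ rk (rvecℚ rk) ε
  ¬MeetsQ-rvecℚ P {ε} 0<ε (w , (t , t≥0 , _ , Σt≡1 , w≡) , (_ , w≤rk)) =
    1≢0 (trans (sym Σt≡1) (Σℚ-zero n (λ k → ≤-antisym (t≤0 k) (t≥0 k))))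
    where
    t≤0 : ∀ k → t k ≤ 0ℚ
    t≤0 k = *-cancelˡ-≤-pos ε {{positive 0<ε}} (+-cancelˡ-≤ rkA (begin
      rkA + ε * t k                               ≡⟨ cong₂ (λ x y → x + ε * y)
                                                       (ΣOver-prefix-rvecℚ P (toℕ<n k)) (slope-prefix t k) ⟨
      ΣOver A (rvecℚ rk) + ε * slope A t          ≡⟨ ΣOver-translate A (rvecℚ rk) ε t ⟨
      ΣOver A (translate (rvecℚ rk) ε t)          ≡⟨ ΣOver-congʳ A w≡ ⟨
      ΣOver A w                                   ≤⟨ w≤rk A ⟩
      rkA                                         ≡⟨ +-identityʳ rkA ⟨
      rkA + 0ℚ                                    ≡⟨ cong (_+_ rkA) (*-zeroʳ ε) ⟨
      rkA + ε * 0ℚ                                ∎))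
      where
      open ≤-Reasoning
      A : Subset n
      A = prefix (suc (toℕ k))
      rkA : ℚ
      rkA = ℕ→ℚ (rk A)

-- If every set containing i but not j is slack at u, then moving from u along eᵢ - eⱼ, written as the
-- uniform combination of the generators between i and j, stays in Q for all small ε.
module _ {n} {rk : Subset n → ℕ} (P : IsPolymatroid n rk) {u : Fin n → ℚ} (u∈Q : u ∈Q rk)
         {i j : Fin n} (i<j : toℕ i ℕ.< toℕ j)
         (strict : ∀ A → A i ≡ true → A j ≡ false → ΣOver A u < ℕ→ℚ (rk A)) where

  private
    d : ℚ
    d = ℕ→ℚ (toℕ j) - ℕ→ℚ (toℕ i)

    1≤d : 1ℚ ≤ d
    1≤d = subst (_≤ d) (solve 1 (λ a → (a :+ con 1ℚ) :- a := con 1ℚ) refl (ℕ→ℚ (toℕ i)))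
      (+-monoˡ-≤ (- ℕ→ℚ (toℕ i)) (subst (_≤ ℕ→ℚ (toℕ j)) (ℕ→ℚ-suc (toℕ i)) (ℕ→ℚ-mono-≤ i<j)))

    instance
      d-positive : Positive d
      d-positive = positive (<-≤-trans 0<1 1≤d)
      d-nonZero : NonZero d
      d-nonZero = pos⇒nonZero d

    -- Kept abstract so that 1/ d is never normalised.
    abstract
      c : ℚ
      c = 1/ d

      c*d≡1 : c * d ≡ 1ℚ
      c*d≡1 = *-inverseˡ d

      0≤c : 0ℚ ≤ c
      0≤c = <⇒≤ (positive⁻¹ c {{1/pos⇒pos d}})

    c≤1 : c ≤ 1ℚ
    c≤1 = subst₂ _≤_ (*-identityʳ c) c*d≡1 (*-monoˡ-≤-nonNeg c {{nonNegative 0≤c}} 1≤d)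

    I : Subset n
    I = interval (toℕ i) (toℕ j)

    t : Fin n → ℚ
    t k = if I k then c else 0ℚ

    t≥0 : ∀ k → 0ℚ ≤ t k
    t≥0 k with I k
    ... | true  = 0≤c
    ... | false = ≤-refl

    t-supported : Supported t
    t-supported k n<k+2 with I k in k∈I
    ... | false = refl
    ... | true  = ⊥-elim (ℕ.<⇒≱ (ℕ.<ᵇ⇒< n _ n<k+2) (ℕ.≤-trans (s≤s k<j) (toℕ<n j)))
      where
      k<j : toℕ k ℕ.< toℕ j
      k<j = ℕ.<ᵇ⇒< (toℕ k) (toℕ j) (proj₂ (Equivalence.to T-∧ (subst T (sym k∈I) tt)))

    Σt≡1 : Σℚ n t ≡ 1ℚ
    Σt≡1 = begin
      ΣOver I (λ _ → c)                                   ≡⟨ ΣOver-congʳ I (λ k → c≡c*step (toℕ k)) ⟩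
      ΣOver I (λ k → c * (ℕ→ℚ (suc (toℕ k)) - ℕ→ℚ (toℕ k)))  ≡⟨ ΣOver-*ˡ I c _ ⟩
      c * ΣOver I (λ k → ℕ→ℚ (suc (toℕ k)) - ℕ→ℚ (toℕ k))
        ≡⟨ cong (c *_) (ΣOver-interval-telescope n ℕ→ℚ (ℕ.<⇒≤ i<j) (ℕ.<⇒≤ (toℕ<n j))) ⟩
      c * d                                               ≡⟨ c*d≡1 ⟩
      1ℚ                                                  ∎
      where
      open ≡-Reasoning
      c≡c*step : ∀ a → c ≡ c * (ℕ→ℚ (suc a) - ℕ→ℚ a)
      c≡c*step a = sym (trans (cong (λ x → c * (x - ℕ→ℚ a)) (ℕ→ℚ-suc a))
        (trans (cong (c *_) (solve 1 (λ x → (x :+ con 1ℚ) :- x := con 1ℚ) refl (ℕ→ℚ a))) (*-identityʳ c)))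

    -- Sets containing j or missing i only decrease along eᵢ - eⱼ, so they need no bound (1 is arbitrary).
    gap : Subset n → ℚ
    gap A = if A i ∧ not (A j) then ℕ→ℚ (rk A) - ΣOver A u else 1ℚ

    gap-cong : ∀ {A B} → A ≐ B → gap A ≡ gap B
    gap-cong {A} {B} A≐B =
      trans (cong₂ (λ a b → if a ∧ not b then ℕ→ℚ (rk A) - ΣOver A u else 1ℚ) (A≐B i) (A≐B j))
            (cong (λ x → if B i ∧ not (B j) then x else 1ℚ)
                  (cong₂ _-_ (cong ℕ→ℚ (rk-cong P A≐B)) (ΣOver-congˡ u A≐B)))

    0<gap : ∀ A → 0ℚ < gap A
    0<gap A = at (A i) (A j) refl refl
      where
      at : ∀ a b → A i ≡ a → A j ≡ b → 0ℚ < (if a ∧ not b then ℕ→ℚ (rk A) - ΣOver A u else 1ℚ)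
      at true  false i∈A j∉A = p<q⇒0<q-p (strict A i∈A j∉A)
      at true  true  _   _   = 0<1
      at false _     _   _   = 0<1

    stays-in-Q : ∀ A {ε} → 0ℚ ≤ ε → ε < gap A → ΣOver A u + ε * slope A t ≤ ℕ→ℚ (rk A)
    stays-in-Q A {ε} 0≤ε ε<gap =
      subst (λ y → x + ε * y ≤ R) (sym (slope-interval A c (ℕ.<⇒≤ i<j))) (at (A i) (A j) ε<gap)
      where
      open ≤-Reasoning
      x R : ℚ
      x = ΣOver A u
      R = ℕ→ℚ (rk A)
      nonpositive-step : ∀ {y} → y ≤ 0ℚ → x + ε * (c * y) ≤ R
      nonpositive-step {y} y≤0 = begin
        x + ε * (c * y)   ≤⟨ +-monoʳ-≤ x (*-monoˡ-≤-nonNeg ε {{nonNegative 0≤ε}}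
                                           (*-monoˡ-≤-nonNeg c {{nonNegative 0≤c}} y≤0)) ⟩
        x + ε * (c * 0ℚ)  ≡⟨ cong (λ z → x + ε * z) (*-zeroʳ c) ⟩
        x + ε * 0ℚ        ≡⟨ cong (_+_ x) (*-zeroʳ ε) ⟩
        x + 0ℚ            ≡⟨ +-identityʳ x ⟩
        x                 ≤⟨ proj₂ u∈Q A ⟩
        R                 ∎
      at : ∀ a b → ε < (if a ∧ not b then R - x else 1ℚ) → x + ε * (c * (⟦ a ⟧ - ⟦ b ⟧)) ≤ R
      at true false ε<R-x = begin
        x + ε * (c * 1ℚ)  ≡⟨ cong (λ z → x + ε * z) (*-identityʳ c) ⟩
        x + ε * c         ≤⟨ +-monoʳ-≤ x (*-monoˡ-≤-nonNeg ε {{nonNegative 0≤ε}} c≤1) ⟩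
        x + ε * 1ℚ        ≡⟨ cong (_+_ x) (*-identityʳ ε) ⟩
        x + ε             ≤⟨ +-monoʳ-≤ x (<⇒≤ ε<R-x) ⟩
        x + (R - x)       ≡⟨ solve 2 (λ x R → x :+ (R :- x) := R) refl x R ⟩
        R                 ∎
      at true  true  _ = nonpositive-step (≤-refl {0ℚ})
      at false true  _ = nonpositive-step (toWitness {a? = 0ℚ - 1ℚ ≤? 0ℚ} tt)
      at false false _ = nonpositive-step (≤-refl {0ℚ})

  MeetsQ-eventually : Eventually (MeetsQ rk u)
  MeetsQ-eventually with positive-lower-bound n gap gap-cong 0<gap
  ... | ε₀ , 0<ε₀ , ε₀≤gap = ε₀ , 0<ε₀ , λ ε 0<ε ε<ε₀ →
    translate u ε t , (t , t≥0 , t-supported , Σt≡1 , λ _ → refl) ,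
    ( trans (Σℚ-translate u ε t t-supported) (proj₁ u∈Q)
    , λ A → subst (_≤ ℕ→ℚ (rk A)) (sym (ΣOver-translate A u ε t))
                  (stays-in-Q A (<⇒≤ 0<ε) (<-≤-trans ε<ε₀ (ε₀≤gap A))))

module _ {n} {rk : Subset n → ℕ} (P : IsPolymatroid n rk) {v : Fin n → ℚ} (v∈Q : v ∈Q rk)
         {i : Fin n} (agree : ∀ k → toℕ k ℕ.< toℕ i → v k ≡ rvecℚ rk k) where

  private
    r : Fin n → ℚ
    r = rvecℚ rk

  ΣOver-agree : ∀ A → A i ≡ true → (∀ k → toℕ i ℕ.< toℕ k → A k ≡ false) →
    ΣOver A v + r i ≡ ΣOver A r + v i
  ΣOver-agree A i∈A above∉A = begin
    ΣOver A v + r i                             ≡⟨ cong (_+_ (ΣOver A v)) (Σℚ-pick n (λ _ → r i) i) ⟨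
    ΣOver A v + Σℚ n (λ k → at k (r i))         ≡⟨ Σℚ-+ n _ _ ⟨
    Σℚ n (λ k → (if A k then v k else 0ℚ) + at k (r i))  ≡⟨ Σℚ-cong n exchange ⟩
    Σℚ n (λ k → (if A k then r k else 0ℚ) + at k (v i))  ≡⟨ Σℚ-+ n _ _ ⟩
    ΣOver A r + Σℚ n (λ k → at k (v i))         ≡⟨ cong (_+_ (ΣOver A r)) (Σℚ-pick n (λ _ → v i) i) ⟩
    ΣOver A r + v i                             ∎
    where
    open ≡-Reasoning
    at : Fin n → ℚ → ℚ
    at k x = if toℕ k ≡ᵇ toℕ i then x else 0ℚ
    exchange : ∀ k → (if A k then v k else 0ℚ) + at k (r i) ≡ (if A k then r k else 0ℚ) + at k (v i)
    exchange k with compareᵇ (toℕ k) (toℕ i)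
    ... | less k<i _ k≢i rewrite k≢i =
      cong (λ x → (if A k then x else 0ℚ) + 0ℚ) (agree k (ℕ.<ᵇ⇒< _ _ (subst T (sym k<i) tt)))
    ... | equal k≡i _ _ k≡ᵇi rewrite k≡ᵇi | toℕ-injective {i = k} {j = i} k≡i | i∈A = +-comm (v i) (r i)
    ... | greater _ k≮1+i k≢i
      rewrite k≢i | above∉A k (ℕ.<ᵇ⇒< (toℕ i) (toℕ k) (<ᵇ≡false⇒<ᵇsuc {toℕ k} {suc (toℕ i)} k≮1+i)) = refl

  v≤rvecℚ : v i ≤ r i
  v≤rvecℚ = +-cancelˡ-≤ (ΣOver A r) (begin
    ΣOver A r + v i     ≡⟨ ΣOver-agree A (<ᵇ-suc (toℕ i)) (λ k i<k → <⇒<ᵇsuc≡false i<k) ⟨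
    ΣOver A v + r i     ≤⟨ +-monoˡ-≤ (r i) (proj₂ v∈Q A) ⟩
    ℕ→ℚ (rk A) + r i   ≡⟨ cong (_+ r i) (ΣOver-prefix-rvecℚ P (toℕ<n i)) ⟨
    ΣOver A r + r i     ∎)
    where
    open ≤-Reasoning
    A : Subset n
    A = prefix (suc (toℕ i))

  rvecℚ≤v : (∀ j → toℕ i ℕ.< toℕ j → ∃ λ A → Tight rk v A × A i ≡ true × A j ≡ false) → r i ≤ v i
  rvecℚ≤v separator = +-cancelˡ-≤ (ΣOver S v) (begin
    ΣOver S v + r i     ≡⟨ ΣOver-agree S i∈S above∉S ⟩
    ΣOver S r + v i     ≤⟨ +-monoˡ-≤ (v i) (ΣOver-rvecℚ-≤ P S) ⟩
    ℕ→ℚ (rk S) + v i   ≡⟨ cong (_+ v i) S-tight ⟨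
    ΣOver S v + v i     ∎)
    where
    open ≤-Reasoning
    separator′ : ∀ j → ∃ λ A → Tight rk v A × A i ≡ true × (toℕ i ℕ.< toℕ j → A j ≡ false)
    separator′ j with toℕ i ℕ.<? toℕ j
    ... | yes i<j = let A , A-tight , i∈A , j∉A = separator j i<j in A , A-tight , i∈A , λ _ → j∉A
    ... | no  i≮j = full , proj₁ v∈Q , refl , λ i<j → ⊥-elim (i≮j i<j)
    S : Subset n
    S = ⋂ (proj₁ ∘ separator′)
    S-tight : Tight rk v S
    S-tight = Tight-⋂ P v∈Q (proj₁ ∘ separator′) (proj₁ ∘ proj₂ ∘ separator′)
    i∈S : S i ≡ true
    i∈S = ∈-⋂ (proj₁ ∘ separator′) i (proj₁ ∘ proj₂ ∘ proj₂ ∘ separator′)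
    above∉S : ∀ k → toℕ i ℕ.< toℕ k → S k ≡ false
    above∉S k i<k = ∉-⋂ (proj₁ ∘ separator′) k k (proj₂ (proj₂ (proj₂ (separator′ k))) i<k)

  private
    Strict : Fin n → Subset n → Set
    Strict j A = A i ≡ true → A j ≡ false → ΣOver A v < ℕ→ℚ (rk A)

    Strict-resp : ∀ j → Respects≐ (Strict j)
    Strict-resp j A≐B strict i∈B j∉B = subst₂ _<_ (ΣOver-congˡ v A≐B) (cong ℕ→ℚ (rk-cong P A≐B))
      (strict (trans (A≐B i) i∈B) (trans (A≐B j) j∉B))

    Strict? : ∀ j A → Dec (Strict j A)
    Strict? j A = (A i ≟ᵇ true) →-dec ((A j ≟ᵇ false) →-dec (ΣOver A v <? ℕ→ℚ (rk A)))

    separator-of-¬Strict : ∀ j A → ¬ Strict j A → Tight rk v A × A i ≡ true × A j ≡ false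
    separator-of-¬Strict j A ¬strict with A i | A j
    ... | false | _     = ⊥-elim (¬strict (λ ()))
    ... | true  | true  = ⊥-elim (¬strict (λ _ ()))
    ... | true  | false = ≤-antisym (proj₂ v∈Q A) (≮⇒≥ (λ lt → ¬strict (λ _ _ → lt))) , refl , refl

    strict-or-separator : ∀ j → (toℕ i ℕ.< toℕ j × (∀ A → Strict j A))
      ⊎ (toℕ i ℕ.< toℕ j → ∃ λ A → Tight rk v A × A i ≡ true × A j ≡ false)
    strict-or-separator j with toℕ i ℕ.<? toℕ j
    ... | no i≮j  = inj₂ (λ i<j → ⊥-elim (i≮j i<j))
    ... | yes i<j with ∀⊎∃¬ n (Strict-resp j) (Strict? j)
    ...   | inj₁ strict       = inj₁ (i<j , strict)
    ...   | inj₂ (A , ¬strict) = inj₂ (λ _ → A , separator-of-¬Strict j A ¬strict)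

  strict-direction : v i ≢ r i →
    ∃ λ j → toℕ i ℕ.< toℕ j × (∀ A → A i ≡ true → A j ≡ false → ΣOver A v < ℕ→ℚ (rk A))
  strict-direction v≢r with ∃⊎∀ strict-or-separator
  ... | inj₁ (j , i<j , strict) = j , i<j , strict
  ... | inj₂ separator          = ⊥-elim (v≢r (≤-antisym v≤rvecℚ (rvecℚ≤v separator)))

module _ {n} {rk : Subset n → ℕ} (P : IsPolymatroid n rk) where

  MeetsQ-eventually-off-rvecℚ : ∀ {v} → v ∈Q rk → ¬ (∀ k → v k ≡ rvecℚ rk k) → Eventually (MeetsQ rk v)
  MeetsQ-eventually-off-rvecℚ {v} v∈Q v≢r =
    let i , v≢r-at-i , before = ¬∀⟶∃¬-smallest n _ (λ k → v k ≟ rvecℚ rk k) v≢r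
        agree : ∀ k → toℕ k ℕ.< toℕ i → v k ≡ rvecℚ rk k
        agree k k<i = subst (λ k → v k ≡ rvecℚ rk k)
          (toℕ-injective (trans (toℕ-inject (fromℕ< k<i)) (toℕ-fromℕ< k<i))) (before (fromℕ< k<i))
        j , i<j , strict = strict-direction P v∈Q agree v≢r-at-i
    in MeetsQ-eventually P v∈Q i<j strict

  ∈Q⊎eventually-¬MeetsQ : ∀ v → v ∈Q rk ⊎ (¬ v ∈Q rk × Eventually (λ ε → ¬ MeetsQ rk v ε))
  ∈Q⊎eventually-¬MeetsQ v with Σℚ n v ≟ ℕ→ℚ (rk full)
  ... | no Σv≢rk = inj₂ (Σv≢rk ∘ proj₁ , always⇒Eventually (λ ε _ → ¬MeetsQ-Σ≢ {rk = rk} ε Σv≢rk))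
  ... | yes Σv≡rk with ∀⊎∃¬ n (λ A≐B → subst₂ _≤_ (ΣOver-congˡ v A≐B) (cong ℕ→ℚ (rk-cong P A≐B)))
                              (λ A → ΣOver A v ≤? ℕ→ℚ (rk A))
  ...   | inj₁ v≤rk       = inj₁ (Σv≡rk , v≤rk)
  ...   | inj₂ (A , v≰rk) = inj₂ ( (λ v∈Q → v≰rk (proj₂ v∈Q A))
                                 , ΣOver A v - ℕ→ℚ (rk A) , p<q⇒0<q-p (≰⇒> v≰rk)
                                 , λ ε 0<ε ε<gap → ¬MeetsQ-violated {rk = rk} A (<⇒≤ 0<ε) ε<gap)

μQ≡-intro : ∀ {n} {v : Fin n → ℤ} {rk a L} →
  IndicatorIs ((ℤ→ℚ ∘ v) ∈Q rk) a → Eventually (λ ε → χSimplexQ (ℤ→ℚ ∘ v) rk ε L) →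
  μQ≡ v rk (a ℤ.- L)
μQ≡-intro v∈Q? eventually = _ , _ , v∈Q? , eventually , refl

corollary8p7 : (n : ℕ) (rk : Subset n → ℕ) → IsPolymatroid n rk →
    (v : Fin n → ℤ) →
    ((∀ i → v i ≡ rvec rk i) → μQ≡ v rk (+ 1)) ×
    (¬ (∀ i → v i ≡ rvec rk i) → μQ≡ v rk (+ 0))
corollary8p7 n rk P v = μ-at-rvec , μ-off-rvec
  where
  v′ : Fin n → ℚ
  v′ = ℤ→ℚ ∘ v
  μ-at-rvec : (∀ i → v i ≡ rvec rk i) → μQ≡ v rk (+ 1)
  μ-at-rvec v≡r = μQ≡-intro {v = v} {rk = rk}
    (inj₁ (refl , ∈Q-cong {rk = rk} r≡v′ (rvecℚ∈Q P)))
    (always⇒Eventually (λ ε 0<ε → inj₂ (refl , ¬MeetsQ-rvecℚ P 0<ε ∘ MeetsQ-cong {rk = rk} {ε = ε} (sym ∘ r≡v′))))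
    where
    r≡v′ : ∀ i → rvecℚ rk i ≡ v′ i
    r≡v′ i = cong ℤ→ℚ (sym (v≡r i))
  μ-off-rvec : ¬ (∀ i → v i ≡ rvec rk i) → μQ≡ v rk (+ 0)
  μ-off-rvec v≢r with ∈Q⊎eventually-¬MeetsQ P v′
  ... | inj₁ v′∈Q = μQ≡-intro {v = v} {rk = rk}
    (inj₁ (refl , v′∈Q))
    (Eventually-map (λ meets → inj₁ (refl , meets))
      (MeetsQ-eventually-off-rvecℚ P v′∈Q (λ v′≡r → v≢r (λ i → ℤ→ℚ-injective (v′≡r i)))))
  ... | inj₂ (v′∉Q , disjoint) = μQ≡-intro {v = v} {rk = rk}
    (inj₂ (refl , v′∉Q))
    (Eventually-map (λ ¬meets → inj₂ (refl , ¬meets)) disjoint)
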